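{- Consider the Zeckendorf game on $n$ with $p$ players and let $A$ be an alliance (set of players). Suppose there is an integer $b$ such that whenever player $i$ is not in $A$, player $(i-b) \bmod p$ is in $A$, and suppose $A$ contains at least $3b$ cyclically consecutive players. If $n \geq 2p+4b$, then $A$ has a winning strategy.
   Context: Let $F_1=1$, $F_2=2$, $F_{i+1}=F_i+F_{i-1}$. The Zeckendorf game on $n$ starts with the multiset of $n$ copies of $1$. A move is one of: if the list contains $F_{i-1}$ and $F_i$, replace them by $F_{i+1}$; if the list contains two copies of $F_i$: for $i=1$ replace them by $F_2$; for $i=2$ replace them by $F_1,F_3$; for $i\geq 3$ replace them by $F_{i-2},F_{i+1}$. The game ends when the list is the Zeckendorf decomposition of $n$ (distinct, pairwise non-consecutive Fibonacci numbers); every game terminates. With $p$ players, players $1,\dots,p$ (indices taken mod $p$) move in cyclic order $1,2,\dots,p,1,2,\dots$ starting with player 1; players $i$ and $i+1 \pmod p$ are consecutive. An alliance wins if the final move (creating the Zeckendorf decomposition) is made by one of its members; it has a winning strategy if its members can choose their moves so that the final move is made by a member no matter what moves the other players make. -}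

module Defs where

open import Data.Nat using (ℕ; zero; suc; _+_; _*_; _∸_; _≤_; NonZero)
open import Data.Nat.DivMod using (_mod_)
open import Data.Fin.Subset using (Subset; _∈_; _∉_)
open import Data.Product using (Σ; _×_)
open import Data.Sum using (_⊎_)
open import Data.Empty using (⊥)
open import Relation.Nullary using (¬_)
open import Relation.Binary.PropositionalEquality using (_≡_)

-- Fibonacci numbers with F 1 = 1, F 2 = 2, F (i+1) = F i + F (i-1)
-- (index 0 is a dummy; only indices ≥ 1 are Fibonacci numbers of the game).
F : ℕ → ℕ
F zero = 0
F (suc zero) = 1
F (suc (suc zero)) = 2
F (suc (suc (suc i))) = F (suc (suc i)) + F (suc i)

-- A position of the game: a finite multiset of Fibonacci numbers, given by
-- its multiplicities: s i = number of copies of F i in the list (i ≥ 1).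
-- Since F is strictly increasing on indices ≥ 1, this is the same as a
-- multiset of Fibonacci numbers.  Index 0 is never used (always 0).
State : Set
State = ℕ → ℕ

δ : ℕ → ℕ → ℕ
δ zero zero = 1
δ zero (suc k) = 0
δ (suc i) zero = 0
δ (suc i) (suc k) = δ i k

start : ℕ → State
start n k = n * δ 1 k

-- The legal moves s ⟶ s' (the new multiplicities are given pointwise,
-- in additive form: s' + removed ≡ s + added).
data Move (s s' : State) : Set where
  -- F j , F (j+1)  ↦  F (j+2)      (j ≥ 1)
  combine : (j : ℕ) → 1 ≤ j → 1 ≤ s j → 1 ≤ s (suc j) →
            (∀ k → s' k + δ j k + δ (suc j) k ≡ s k + δ (suc (suc j)) k) →
            Move s s'
  -- F 1 , F 1  ↦  F 2
  split1  : 2 ≤ s 1 →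
            (∀ k → s' k + 2 * δ 1 k ≡ s k + δ 2 k) →
            Move s s'
  -- F 2 , F 2  ↦  F 1 , F 3
  split2  : 2 ≤ s 2 →
            (∀ k → s' k + 2 * δ 2 k ≡ s k + δ 1 k + δ 3 k) →
            Move s s'
  -- F i , F i  ↦  F (i-2) , F (i+1)    (i ≥ 3)
  splitn  : (i : ℕ) → 3 ≤ i → 2 ≤ s i →
            (∀ k → s' k + 2 * δ i k ≡ s k + δ (i ∸ 2) k + δ (suc i) k) →
            Move s s'

-- The list is a Zeckendorf decomposition: the Fibonacci numbers occurring
-- are distinct and pairwise non-consecutive.  (The sum is invariant under
-- moves, so in the game this is the Zeckendorf decomposition of n.)
Zeckendorf : State → Set
Zeckendorf s = (∀ k → s k ≤ 1) × (∀ k → s k ≡ 1 → s (suc k) ≡ 1 → ⊥)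

-- Game with p players (turn t, counted from 0, is made by player t mod p;
-- player "1" of the paper is Fin index 0) and an alliance A ⊆ players.
module Game (p : ℕ) .{{_ : NonZero p}} (A : Subset p) where

  -- Win s t : at position s, with the move number t to be played next,
  -- the alliance A can force that the final move (the one producing the
  -- Zeckendorf decomposition) is made by a member of A.
  data Win (s : State) (t : ℕ) : Set where
    ally  : t mod p ∈ A → (s' : State) → Move s s' →
            (Zeckendorf s' ⊎ Win s' (suc t)) → Win s t
    -- a non-member moves: the game is not over, and every move leads to
    -- a winning position for A (in particular no move ends the game,
    -- since Win of a finished position is uninhabited)
    enemy : t mod p ∉ A → ¬ Zeckendorf s →
            ((s' : State) → Move s s' → Win s' (suc t)) → Win s t

  HasWinningStrategy : ℕ → Set
  HasWinningStrategy n = Win (start n) 0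

-- Let T = s mod p be the first of the 3b allied turns.  Until then the alliance merges 1 + 1 ↦ 2
-- whenever it moves; no move destroys more than two copies of 1, so as n ≥ 2p + 4b at least 3b + 2
-- of them survive to turn T.  Three 1s can be traded for a 3 in two moves (1+1 ↦ 2, 1+2 ↦ 3) or in
-- three (1+1 ↦ 2 twice, 2+2 ↦ 1+3), so with its block of turns the alliance can reach the position z
-- obtained by b such trades either at turn T + 2b or at turn T + 3b.  The game is finite, hence
-- determined from z at turn T + 3b.  If the alliance wins there, it takes the slow route.  Otherwise
-- its opponents win there, i.e. the turns u with u + b not allied win from z at turn T + 2b; by
-- hypothesis all such u are allied, and more turns never hurt, so the alliance takes the fast route.

{-# OPTIONS --safe #-}
module Submission where

open import Defs
open import Data.Empty using (⊥; ⊥-elim)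
open import Data.Fin.Properties using (fromℕ<-cong)
open import Data.Fin.Subset using (Subset; _∈_; _∉_)
open import Data.Fin.Subset.Properties using (_∈?_)
open import Data.List using (List; []; _∷_)
open import Data.List.Membership.Propositional using () renaming (_∈_ to _∈ᴸ_)
open import Data.List.Relation.Unary.Any using (here; there)
open import Data.Nat using (ℕ; zero; suc; _+_; _*_; _∸_; _≤_; _<_; _≤?_; _<?_; _≟_; z≤n; s≤s; NonZero)
open import Data.Nat.DivMod using (_mod_; _%_; %-distribˡ-+; m%n%n≡m%n; m%n<n)
open import Data.Nat.GeneralisedArithmetic using (iterate)
open import Data.Nat.Induction using (<-wellFounded)
open import Data.Nat.Properties
open import Data.Nat.Tactic.RingSolver using (solve-∀)
open import Data.Product using (Σ; _×_; _,_; proj₁; proj₂; ∃)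
open import Data.Product.Relation.Binary.Lex.Strict using (×-Lex; ×-wellFounded)
open import Data.Sum using (_⊎_; inj₁; inj₂; [_,_]′; swap)
open import Function using (_∘_; id; const)
open import Induction.WellFounded using (Acc; acc; WellFounded)
open import Relation.Binary.PropositionalEquality
  using (_≡_; _≢_; _≗_; refl; sym; trans; cong; cong₂; subst; module ≡-Reasoning)
open import Relation.Nullary using (¬_; Dec; yes; no)
open import Relation.Nullary.Decidable using (_×-dec_; toSum)

m+n≡o⇒m≡o∸n : ∀ {m n o} → m + n ≡ o → m ≡ o ∸ n
m+n≡o⇒m≡o∸n {m} {n} refl = sym (m+n∸n≡m m n)

m+a≡n+b⇒m<n : ∀ {m n a b} → b < a → m + a ≡ n + b → m < n
m+a≡n+b⇒m<n {m} {n} {a} {b} b<a e = +-cancelʳ-< b m n (subst (m + b <_) e (+-monoʳ-< m b<a))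

c+m≤n⇒m≤n+0∸c : ∀ c {m n} → c + m ≤ n → m ≤ n + 0 ∸ c
c+m≤n⇒m≤n+0∸c c {m} {n} h rewrite +-identityʳ n = m+n≤o⇒m≤o∸n m (subst (_≤ n) (+-comm c m) h)

find-or-all : ∀ {A : Set} {Q R : A → Set} → (∀ x → Q x ⊎ R x) → ∀ xs → ∃ Q ⊎ (∀ {x} → x ∈ᴸ xs → R x)
find-or-all f [] = inj₂ λ ()
find-or-all f (x ∷ xs) with f x | find-or-all f xs
... | inj₁ q | _ = inj₁ (x , q)
... | inj₂ _ | inj₁ found = inj₁ found
... | inj₂ r | inj₂ rs = inj₂ λ { (here refl) → r ; (there m) → rs m }

-- Game.Win, with membership of the alliance replaced by an arbitrary set of turns.
data Wins (P : ℕ → Set) (s : State) (t : ℕ) : Set where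
  ally  : P t → (s' : State) → Move s s' → Zeckendorf s' ⊎ Wins P s' (suc t) → Wins P s t
  enemy : ¬ P t → ¬ Zeckendorf s → (∀ s' → Move s s' → Wins P s' (suc t)) → Wins P s t

module _ {s₁ s₂ : State} (s₁≗s₂ : s₁ ≗ s₂) where

  Move-resp : ∀ {s'} → Move s₁ s' → Move s₂ s'
  Move-resp (combine j 1≤j h₁ h₂ e) =
    combine j 1≤j (subst (1 ≤_) (s₁≗s₂ j) h₁) (subst (1 ≤_) (s₁≗s₂ (suc j)) h₂)
      (λ k → subst (λ x → _ ≡ x + _) (s₁≗s₂ k) (e k))
  Move-resp (split1 h e) = split1 (subst (2 ≤_) (s₁≗s₂ 1) h) (λ k → subst (λ x → _ ≡ x + _) (s₁≗s₂ k) (e k))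
  Move-resp (split2 h e) = split2 (subst (2 ≤_) (s₁≗s₂ 2) h) (λ k → subst (λ x → _ ≡ x + _ + _) (s₁≗s₂ k) (e k))
  Move-resp (splitn i 3≤i h e) =
    splitn i 3≤i (subst (2 ≤_) (s₁≗s₂ i) h) (λ k → subst (λ x → _ ≡ x + _ + _) (s₁≗s₂ k) (e k))

  Zeckendorf-resp : Zeckendorf s₁ → Zeckendorf s₂
  Zeckendorf-resp (≤1 , apart) =
    (λ k → subst (_≤ 1) (s₁≗s₂ k) (≤1 k)) ,
    (λ k e₁ e₂ → apart k (trans (s₁≗s₂ k) e₁) (trans (s₁≗s₂ (suc k)) e₂))

Wins-resp : ∀ {P s₁ s₂ t} → s₁ ≗ s₂ → Wins P s₁ t → Wins P s₂ t
Wins-resp eq (ally pt s' m next) = ally pt s' (Move-resp eq m) next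
Wins-resp eq (enemy ¬pt ¬z next) =
  enemy ¬pt (¬z ∘ Zeckendorf-resp (sym ∘ eq)) (λ s' m → next s' (Move-resp (sym ∘ eq) m))

δ-diag : ∀ i → δ i i ≡ 1
δ-diag zero = refl
δ-diag (suc i) = δ-diag i

δ-≢ : ∀ {i k} → i ≢ k → δ i k ≡ 0
δ-≢ {zero} {zero} i≢k = ⊥-elim (i≢k refl)
δ-≢ {zero} {suc k} _ = refl
δ-≢ {suc i} {zero} _ = refl
δ-≢ {suc i} {suc k} i≢k = δ-≢ (i≢k ∘ cong suc)

δ≤1 : ∀ i k → δ i k ≤ 1
δ≤1 i k with i ≟ k
... | yes refl = ≤-reflexive (δ-diag i)
... | no i≢k = ≤-trans (≤-reflexive (δ-≢ i≢k)) z≤n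

*δ≤ : ∀ {c} (f : ℕ → ℕ) i k → c ≤ f i → c * δ i k ≤ f k
*δ≤ {c} f i k c≤fi with i ≟ k
... | yes refl = subst (_≤ f i) (sym (trans (cong (c *_) (δ-diag i)) (*-identityʳ c))) c≤fi
... | no i≢k = subst (_≤ f k) (sym (trans (cong (c *_) (δ-≢ i≢k)) (*-zeroʳ c))) z≤n

-- Codes for the constructors of Move; play s r is the resulting position only when
-- Applicable s r, since otherwise the subtraction truncates.
data Rule : Set where
  comb : ℕ → Rule
  sp1 sp2 : Rule
  spn : ℕ → Rule

removed added : Rule → State
removed (comb j) k = δ j k + δ (suc j) k
removed sp1 k = 2 * δ 1 k
removed sp2 k = 2 * δ 2 k
removed (spn i) k = 2 * δ i k
added (comb j) k = δ (suc (suc j)) k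
added sp1 k = δ 2 k
added sp2 k = δ 1 k + δ 3 k
added (spn i) k = δ (i ∸ 2) k + δ (suc i) k

play : State → Rule → State
play s r k = (s k + added r k) ∸ removed r k

Applicable : State → Rule → Set
Applicable s (comb j) = 1 ≤ j × 1 ≤ s j × 1 ≤ s (suc j)
Applicable s sp1 = 2 ≤ s 1
Applicable s sp2 = 2 ≤ s 2
Applicable s (spn i) = 3 ≤ i × 2 ≤ s i

applicable? : ∀ s r → Dec (Applicable s r)
applicable? s (comb j) = (1 ≤? j) ×-dec (1 ≤? s j) ×-dec (1 ≤? s (suc j))
applicable? s sp1 = 2 ≤? s 1
applicable? s sp2 = 2 ≤? s 2
applicable? s (spn i) = (3 ≤? i) ×-dec (2 ≤? s i)

removed≤ : ∀ {s} r → Applicable s r → ∀ k → removed r k ≤ s k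
removed≤ {s} (comb j) (_ , h₁ , h₂) k with j ≟ k
... | yes refl rewrite δ-diag j | δ-≢ (<⇒≢ (n<1+n j) ∘ sym) = h₁
... | no j≢k = subst (λ x → x + δ (suc j) k ≤ s k) (sym (δ-≢ j≢k))
                 (subst (_≤ s k) (*-identityˡ (δ (suc j) k)) (*δ≤ s (suc j) k h₂))
removed≤ {s} sp1 h k = *δ≤ s 1 k h
removed≤ {s} sp2 h k = *δ≤ s 2 k h
removed≤ {s} (spn i) (_ , h) k = *δ≤ s i k h

removed≤2 : ∀ r k → removed r k ≤ 2
removed≤2 (comb j) k = +-mono-≤ (δ≤1 j k) (δ≤1 (suc j) k)
removed≤2 sp1 k = *-monoʳ-≤ 2 (δ≤1 1 k)
removed≤2 sp2 k = *-monoʳ-≤ 2 (δ≤1 2 k)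
removed≤2 (spn i) k = *-monoʳ-≤ 2 (δ≤1 i k)

play-balance : ∀ {s} r → Applicable s r → ∀ k → play s r k + removed r k ≡ s k + added r k
play-balance {s} r a k = m∸n+n≡m (≤-trans (removed≤ r a k) (m≤m+n (s k) (added r k)))

rule-move : ∀ {s} r → Applicable s r → Move s (play s r)
rule-move {s} (comb j) a@(1≤j , h₁ , h₂) =
  combine j 1≤j h₁ h₂ (λ k → trans (+-assoc (play s (comb j) k) _ _) (play-balance {s} (comb j) a k))
rule-move {s} sp1 a = split1 a (play-balance {s} sp1 a)
rule-move {s} sp2 a = split2 a (λ k → trans (play-balance {s} sp2 a k) (sym (+-assoc (s k) _ _)))
rule-move {s} (spn i) a@(3≤i , h) =
  splitn i 3≤i h (λ k → trans (play-balance {s} (spn i) a k) (sym (+-assoc (s k) _ _)))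

move-rule : ∀ {s s'} → Move s s' → Σ Rule λ r → Applicable s r × s' ≗ play s r
move-rule {s} {s'} (combine j 1≤j h₁ h₂ e) =
  comb j , (1≤j , h₁ , h₂) , λ k → m+n≡o⇒m≡o∸n (trans (sym (+-assoc (s' k) _ _)) (e k))
move-rule (split1 h e) = sp1 , h , m+n≡o⇒m≡o∸n ∘ e
move-rule {s} (split2 h e) = sp2 , h , λ k → m+n≡o⇒m≡o∸n (trans (e k) (+-assoc (s k) _ _))
move-rule {s} (splitn i 3≤i h e) =
  spn i , (3≤i , h) , λ k → m+n≡o⇒m≡o∸n (trans (e k) (+-assoc (s k) _ _))

Supported : State → ℕ → Set
Supported s N = s 0 ≡ 0 × (∀ k → N ≤ k → s k ≡ 0)

Supported-resp : ∀ {s₁ s₂ N} → s₁ ≗ s₂ → Supported s₁ N → Supported s₂ N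
Supported-resp eq (s0 , beyond) = trans (sym (eq 0)) s0 , λ k N≤k → trans (sym (eq k)) (beyond k N≤k)

Supported-weaken : ∀ {s N M} → N ≤ M → Supported s N → Supported s M
Supported-weaken N≤M (s0 , beyond) = s0 , λ k M≤k → beyond k (≤-trans N≤M M≤k)

occupied<bound : ∀ {s N i} → Supported s N → 1 ≤ s i → i < N
occupied<bound {s} {N} {i} (_ , beyond) 1≤si with i <? N
... | yes i<N = i<N
... | no i≮N = ⊥-elim (1+n≰n (subst (1 ≤_) (beyond i (≮⇒≥ i≮N)) 1≤si))

δ-< : ∀ {i k} → i < k → δ i k ≡ 0
δ-< = δ-≢ ∘ <⇒≢

added-beyond : ∀ {s N} r → Supported s N → Applicable s r → ∀ {k} → N < k → added r k ≡ 0
added-beyond (comb j) sup (_ , _ , h) N<k = δ-< (<-≤-trans (s≤s (occupied<bound sup h)) N<k)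
added-beyond sp1 sup h N<k = δ-< (<-≤-trans (s≤s (occupied<bound sup (≤-trans (n≤1+n 1) h))) N<k)
added-beyond sp2 sup h N<k =
  cong₂ _+_ (δ-< (<-≤-trans (m<n⇒m<1+n 1<N) N<k)) (δ-< (<-≤-trans (s≤s 2<N) N<k))
  where 2<N = occupied<bound sup (≤-trans (n≤1+n 1) h)
        1<N = ≤-<-trans (n≤1+n 1) 2<N
added-beyond (spn i) sup (_ , h) N<k =
  cong₂ _+_ (δ-< (<-≤-trans (≤-<-trans (m∸n≤m i 2) (m<n⇒m<1+n i<N)) N<k)) (δ-< (<-≤-trans (s≤s i<N) N<k))
  where i<N = occupied<bound sup (≤-trans (n≤1+n 1) h)

added-at-0 : ∀ {s} r → Applicable s r → added r 0 ≡ 0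
added-at-0 (comb j) _ = refl
added-at-0 sp1 _ = refl
added-at-0 sp2 _ = refl
added-at-0 (spn (suc (suc (suc i)))) _ = refl
added-at-0 (spn 1) (s≤s () , _)
added-at-0 (spn 2) (s≤s (s≤s ()) , _)

play-supported : ∀ {s N} r → Supported s N → Applicable s r → Supported (play s r) (suc N)
play-supported {s} r sup@(s0 , beyond) a =
  vanish (cong₂ _+_ s0 (added-at-0 r a)) ,
  λ k N<k → vanish (cong₂ _+_ (beyond k (≤-trans (n≤1+n _) N<k)) (added-beyond r sup a N<k))
  where vanish : ∀ {k} → s k + added r k ≡ 0 → play s r k ≡ 0
        vanish {k} e = trans (cong (_∸ removed r k) e) (0∸n≡0 (removed r k))

rules : ℕ → List Rule
rules zero = sp1 ∷ sp2 ∷ []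
rules (suc N) = comb N ∷ spn N ∷ rules N

splits∈rules : ∀ N → sp1 ∈ᴸ rules N × sp2 ∈ᴸ rules N
splits∈rules zero = here refl , there (here refl)
splits∈rules (suc N) = let (m₁ , m₂) = splits∈rules N in there (there m₁) , there (there m₂)

indexed∈rules : ∀ {j N} → j < N → comb j ∈ᴸ rules N × spn j ∈ᴸ rules N
indexed∈rules {j} {suc N} j<1+N with j ≟ N
... | yes refl = here refl , there (here refl)
... | no j≢N = let (m₁ , m₂) = indexed∈rules (≤∧≢⇒< (≤-pred j<1+N) j≢N) in
               there (there m₁) , there (there m₂)

rules-complete : ∀ {s N} r → Supported s N → Applicable s r → r ∈ᴸ rules N
rules-complete (comb j) sup (_ , _ , h) = proj₁ (indexed∈rules (<-trans (n<1+n j) (occupied<bound sup h)))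
rules-complete sp1 _ _ = proj₁ (splits∈rules _)
rules-complete sp2 _ _ = proj₂ (splits∈rules _)
rules-complete (spn i) sup (_ , h) = proj₂ (indexed∈rules (occupied<bound sup (≤-trans (n≤1+n 1) h)))

Zeckendorf⇒stuck : ∀ {s} → Zeckendorf s → ∀ r → ¬ Applicable s r
Zeckendorf⇒stuck (≤1 , apart) (comb j) (_ , h₁ , h₂) =
  apart j (≤-antisym (≤1 j) h₁) (≤-antisym (≤1 (suc j)) h₂)
Zeckendorf⇒stuck (≤1 , _) sp1 h = 1+n≰n (≤-trans h (≤1 1))
Zeckendorf⇒stuck (≤1 , _) sp2 h = 1+n≰n (≤-trans h (≤1 2))
Zeckendorf⇒stuck (≤1 , _) (spn i) (_ , h) = 1+n≰n (≤-trans h (≤1 i))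

stuck⇒Zeckendorf : ∀ {s} → s 0 ≡ 0 → (∀ r → ¬ Applicable s r) → Zeckendorf s
stuck⇒Zeckendorf {s} s0 stuck = ≤1 , apart
  where
  ≤1 : ∀ k → s k ≤ 1
  ≤1 k with 2 ≤? s k
  ... | no 2≰sk = ≤-pred (≰⇒> 2≰sk)
  ≤1 zero | yes h = ⊥-elim (1+n≰n (≤-trans (n≤1+n 1) (subst (2 ≤_) s0 h)))
  ≤1 (suc zero) | yes h = ⊥-elim (stuck sp1 h)
  ≤1 (suc (suc zero)) | yes h = ⊥-elim (stuck sp2 h)
  ≤1 (suc (suc (suc k))) | yes h = ⊥-elim (stuck (spn (3 + k)) (s≤s (s≤s (s≤s z≤n)) , h))
  apart : ∀ k → s k ≡ 1 → s (suc k) ≡ 1 → ⊥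
  apart zero e _ = 1+n≢0 (trans (sym e) s0)
  apart (suc k) e₁ e₂ = stuck (comb (suc k)) (s≤s z≤n , ≤-reflexive (sym e₁) , ≤-reflexive (sym e₂))

rule-or-stuck : ∀ {s N} → Supported s N → ∃ (Applicable s) ⊎ (∀ r → ¬ Applicable s r)
rule-or-stuck {s} {N} sup with find-or-all (toSum ∘ applicable? s) (rules N)
... | inj₁ found = inj₁ found
... | inj₂ none = inj₂ λ r a → none (rules-complete r sup a) a

zeckendorf? : ∀ {s N} → Supported s N → Dec (Zeckendorf s)
zeckendorf? sup with rule-or-stuck sup
... | inj₁ (r , a) = no λ z → Zeckendorf⇒stuck z r a
... | inj₂ stuck = yes (stuck⇒Zeckendorf (proj₁ sup) stuck)

some-rule : ∀ {s N} → Supported s N → ¬ Zeckendorf s → ∃ (Applicable s)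
some-rule sup ¬z with rule-or-stuck sup
... | inj₁ found = found
... | inj₂ stuck = ⊥-elim (¬z (stuck⇒Zeckendorf (proj₁ sup) stuck))

wsum : (ℕ → ℕ) → ℕ → State → ℕ
wsum w zero f = 0
wsum w (suc M) f = wsum w M f + w M * f M

module _ (w : ℕ → ℕ) where

  wsum-cong : ∀ M {f g} → f ≗ g → wsum w M f ≡ wsum w M g
  wsum-cong zero f≗g = refl
  wsum-cong (suc M) f≗g = cong₂ _+_ (wsum-cong M f≗g) (cong (w M *_) (f≗g M))

  wsum-+ : ∀ M f g → wsum w M (λ k → f k + g k) ≡ wsum w M f + wsum w M g
  wsum-+ zero f g = refl
  wsum-+ (suc M) f g =
    trans (cong (_+ w M * (f M + g M)) (wsum-+ M f g)) (interchange (wsum w M f) (wsum w M g) (w M) (f M) (g M))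
    where interchange : ∀ a b x y z → a + b + x * (y + z) ≡ a + x * y + (b + x * z)
          interchange = solve-∀

  wsum-* : ∀ M c f → wsum w M (λ k → c * f k) ≡ c * wsum w M f
  wsum-* zero c f = sym (*-zeroʳ c)
  wsum-* (suc M) c f =
    trans (cong (_+ w M * (c * f M)) (wsum-* M c f)) (factor c (wsum w M f) (w M) (f M))
    where factor : ∀ c a x y → c * a + x * (c * y) ≡ c * (a + x * y)
          factor = solve-∀

  wsum-δ-beyond : ∀ M {j} → M ≤ j → wsum w M (δ j) ≡ 0
  wsum-δ-beyond zero _ = refl
  wsum-δ-beyond (suc M) {j} M<j =
    trans (cong₂ _+_ (wsum-δ-beyond M (≤-trans (n≤1+n M) M<j)) (cong (w M *_) (δ-≢ (<⇒≢ M<j ∘ sym))))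
          (*-zeroʳ (w M))

  wsum-δ : ∀ M {j} → j < M → wsum w M (δ j) ≡ w j
  wsum-δ (suc M) {j} j<1+M with j ≟ M
  ... | yes refl = trans (cong₂ _+_ (wsum-δ-beyond j ≤-refl) (cong (w j *_) (δ-diag j))) (*-identityʳ (w j))
  ... | no j≢M = trans (cong₂ _+_ (wsum-δ M (≤∧≢⇒< (≤-pred j<1+M) j≢M)) (cong (w M *_) (δ-≢ j≢M)))
                       (trans (cong (w j +_) (*-zeroʳ (w M))) (+-identityʳ (w j)))

  wsum-extend : ∀ {s N} → Supported s N → wsum w (suc N) s ≡ wsum w N s
  wsum-extend {s} {N} (_ , beyond) =
    trans (cong (λ x → wsum w N s + w N * x) (beyond N ≤-refl))
          (trans (cong (wsum w N s +_) (*-zeroʳ (w N))) (+-identityʳ _))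

removed-weight added-weight : (ℕ → ℕ) → Rule → ℕ
removed-weight w (comb j) = w j + w (suc j)
removed-weight w sp1 = 2 * w 1
removed-weight w sp2 = 2 * w 2
removed-weight w (spn i) = 2 * w i
added-weight w (comb j) = w (suc (suc j))
added-weight w sp1 = w 2
added-weight w sp2 = w 1 + w 3
added-weight w (spn i) = w (i ∸ 2) + w (suc i)

module _ {s N} (sup : Supported s N) (w : ℕ → ℕ) where

  private
    M = suc N
    <M : ∀ {i} → 1 ≤ s i → i < M
    <M = m<n⇒m<1+n ∘ occupied<bound sup
    <M-of-2 : ∀ {i} → 2 ≤ s i → i < M
    <M-of-2 = <M ∘ ≤-trans (n≤1+n 1)

  wsum-removed : ∀ r → Applicable s r → wsum w M (removed r) ≡ removed-weight w r
  wsum-removed (comb j) (_ , _ , h) =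
    trans (wsum-+ w M (δ j) (δ (suc j))) (cong₂ _+_ (wsum-δ w M (<-trans (n<1+n j) (<M h))) (wsum-δ w M (<M h)))
  wsum-removed sp1 h = trans (wsum-* w M 2 (δ 1)) (cong (2 *_) (wsum-δ w M (<M-of-2 h)))
  wsum-removed sp2 h = trans (wsum-* w M 2 (δ 2)) (cong (2 *_) (wsum-δ w M (<M-of-2 h)))
  wsum-removed (spn i) (_ , h) = trans (wsum-* w M 2 (δ i)) (cong (2 *_) (wsum-δ w M (<M-of-2 h)))

  wsum-added : ∀ r → Applicable s r → wsum w M (added r) ≡ added-weight w r
  wsum-added (comb j) (_ , _ , h) = wsum-δ w M (s≤s (occupied<bound sup h))
  wsum-added sp1 h = wsum-δ w M (s≤s (occupied<bound sup (≤-trans (n≤1+n 1) h)))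
  wsum-added sp2 h =
    trans (wsum-+ w M (δ 1) (δ 3)) (cong₂ _+_ (wsum-δ w M (<-trans (s≤s (s≤s z≤n)) 2<M)) (wsum-δ w M (s≤s 2<N)))
    where 2<N = occupied<bound sup (≤-trans (n≤1+n 1) h)
          2<M = m<n⇒m<1+n 2<N
  wsum-added (spn i) (_ , h) =
    trans (wsum-+ w M (δ (i ∸ 2)) (δ (suc i)))
          (cong₂ _+_ (wsum-δ w M (≤-<-trans (m∸n≤m i 2) (<M-of-2 h)))
                     (wsum-δ w M (s≤s (occupied<bound sup (≤-trans (n≤1+n 1) h)))))

  wsum-play : ∀ r → Applicable s r → wsum w M (play s r) + removed-weight w r ≡ wsum w N s + added-weight w r
  wsum-play r a = begin
    wsum w M (play s r) + removed-weight w r         ≡⟨ cong (wsum w M (play s r) +_) (sym (wsum-removed r a)) ⟩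
    wsum w M (play s r) + wsum w M (removed r)       ≡⟨ sym (wsum-+ w M (play s r) (removed r)) ⟩
    wsum w M (λ k → play s r k + removed r k)        ≡⟨ wsum-cong w M (play-balance {s} r a) ⟩
    wsum w M (λ k → s k + added r k)                 ≡⟨ wsum-+ w M s (added r) ⟩
    wsum w M s + wsum w M (added r)                  ≡⟨ cong₂ _+_ (wsum-extend w sup) (wsum-added r a) ⟩
    wsum w N s + added-weight w r                    ∎
    where open ≡-Reasoning

Measure : Set
Measure = ℕ × ℕ × ℕ

_⊏_ : Measure → Measure → Set
_⊏_ = ×-Lex _≡_ _<_ (×-Lex _≡_ _<_ _<_)

⊏-wellFounded : WellFounded _⊏_
⊏-wellFounded = ×-wellFounded <-wellFounded (×-wellFounded <-wellFounded <-wellFounded)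

-- Number of pieces, sum of their indices, number of copies of F 2: every move except split2 and
-- splitn lowers the number of pieces; splitn keeps it and lowers the index sum; split2 keeps both
-- and lowers the number of copies of F 2.
measure : State → ℕ → Measure
measure s N = wsum (const 1) N s , wsum id N s , s 2

measure-decreases : ∀ {s N} r → Supported s N → Applicable s r → measure (play s r) (suc N) ⊏ measure s N
measure-decreases (comb j) sup a = inj₁ (m+a≡n+b⇒m<n ≤-refl (wsum-play sup (const 1) (comb j) a))
measure-decreases sp1 sup a = inj₁ (m+a≡n+b⇒m<n ≤-refl (wsum-play sup (const 1) sp1 a))
measure-decreases {s} sp2 sup a =
  inj₂ (+-cancelʳ-≡ 2 _ _ (wsum-play sup (const 1) sp2 a) ,
  inj₂ (+-cancelʳ-≡ 4 _ _ (wsum-play sup id sp2 a) ,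
  m+a≡n+b⇒m<n (s≤s z≤n) (play-balance {s} sp2 a 2)))
measure-decreases (spn (suc (suc (suc i)))) sup a =
  inj₂ (+-cancelʳ-≡ 2 _ _ (wsum-play sup (const 1) (spn (3 + i)) a) ,
  inj₁ (m+a≡n+b⇒m<n (≤-reflexive (index-drop i)) (wsum-play sup id (spn (3 + i)) a)))
  where index-drop : ∀ i → suc (suc i + (4 + i)) ≡ 2 * (3 + i)
        index-drop = solve-∀
measure-decreases (spn 1) _ (s≤s () , _)
measure-decreases (spn 2) _ (s≤s (s≤s ()) , _)

move-supported : ∀ {s s' N} → Supported s N → Move s s' → Supported s' (suc N)
move-supported sup m = let (r , a , s'≗) = move-rule m in Supported-resp (sym ∘ s'≗) (play-supported r sup a)

mover-decides : ∀ {P Q : ℕ → Set} {s N t} → Supported s N → ¬ Zeckendorf s → P t → ¬ Q t →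
                (∀ r → Applicable s r → ¬ Zeckendorf (play s r) →
                   Wins P (play s r) (suc t) ⊎ Wins Q (play s r) (suc t)) →
                Wins P s t ⊎ Wins Q s t
mover-decides {P} {Q} {s} {N} {t} sup ¬z pt ¬qt next with find-or-all outcome (rules N)
  where
  outcome : ∀ r → (Applicable s r × (Zeckendorf (play s r) ⊎ Wins P (play s r) (suc t)))
                ⊎ (Applicable s r → Wins Q (play s r) (suc t))
  outcome r with applicable? s r
  ... | no ¬a = inj₂ (⊥-elim ∘ ¬a)
  ... | yes a with zeckendorf? (play-supported r sup a)
  ...   | yes z = inj₁ (a , inj₁ z)
  ...   | no ¬z' = [ (λ w → inj₁ (a , inj₂ w)) , (λ w → inj₂ (const w)) ]′ (next r a ¬z')
... | inj₁ (r , a , won) = inj₁ (ally pt (play s r) (rule-move r a) won)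
... | inj₂ lost = inj₂ (enemy ¬qt ¬z λ s' m →
        let (r , a , s'≗) = move-rule m in Wins-resp (sym ∘ s'≗) (lost (rules-complete r sup a) a))

determined-acc : ∀ {P Q : ℕ → Set} → (∀ t → P t ⊎ Q t) → (∀ t → P t → ¬ Q t) →
                 ∀ {s N} → Acc _⊏_ (measure s N) → Supported s N → ¬ Zeckendorf s →
                 ∀ t → Wins P s t ⊎ Wins Q s t
determined-acc {P} {Q} side disjoint {s} {N} (acc rs) sup ¬z t =
  [ (λ pt → mover-decides sup ¬z pt (disjoint t pt) next)
  , (λ qt → swap (mover-decides sup ¬z qt (λ pt → disjoint t pt qt) (λ r a ¬z' → swap (next r a ¬z'))))
  ]′ (side t)
  where
  next : ∀ r → Applicable s r → ¬ Zeckendorf (play s r) → Wins P (play s r) (suc t) ⊎ Wins Q (play s r) (suc t)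
  next r a ¬z' = determined-acc side disjoint (rs (measure-decreases r sup a)) (play-supported r sup a) ¬z' (suc t)

determined : ∀ {P : ℕ → Set} → (∀ t → Dec (P t)) → ∀ {s N} → Supported s N → ¬ Zeckendorf s →
             ∀ t → Wins P s t ⊎ Wins (¬_ ∘ P) s t
determined P? = determined-acc (toSum ∘ P?) (λ _ p ¬p → ¬p p) (⊏-wellFounded _)

-- On a turn in P but not in Q, any move will do: Q has to win after each of them.
Wins-mono : ∀ {P Q : ℕ → Set} → (∀ t → Dec (P t)) → (∀ t → Q t → P t) →
            ∀ {s N t} → Supported s N → Wins Q s t → Wins P s t
Wins-mono P? Q⊆P sup (ally qt s' m (inj₁ z)) = ally (Q⊆P _ qt) s' m (inj₁ z)
Wins-mono P? Q⊆P sup (ally qt s' m (inj₂ w)) =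
  ally (Q⊆P _ qt) s' m (inj₂ (Wins-mono P? Q⊆P (move-supported sup m) w))
Wins-mono P? Q⊆P {s} {t = t} sup (enemy ¬qt ¬z next) with P? t
... | no ¬pt = enemy ¬pt ¬z λ s' m → Wins-mono P? Q⊆P (move-supported sup m) (next s' m)
... | yes pt = let (r , a) = some-rule sup ¬z in
  ally pt (play s r) (rule-move r a) (inj₂ (Wins-mono P? Q⊆P (play-supported r sup a) (next _ (rule-move r a))))

Wins-shift : ∀ {Q : ℕ → Set} b {s} t → Wins Q s (t + b) → Wins (λ u → Q (u + b)) s t
Wins-shift b t (ally qt s' m (inj₁ z)) = ally qt s' m (inj₁ z)
Wins-shift b t (ally qt s' m (inj₂ w)) = ally qt s' m (inj₂ (Wins-shift b (suc t) w))
Wins-shift b t (enemy ¬qt ¬z next) = enemy ¬qt ¬z λ s' m → Wins-shift b (suc t) (next s' m)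

ones-to-three : State → State
ones-to-three y k = (y k + δ 3 k) ∸ 3 * δ 1 k

short-round-≗ : ∀ y → play (play y sp1) (comb 1) ≗ ones-to-three y
short-round-≗ y 0 = +-identityʳ (y 0 + 0)
short-round-≗ y 1 rewrite +-identityʳ (y 1) | +-identityʳ (y 1 ∸ 2) = ∸-+-assoc (y 1) 2 1
short-round-≗ y 2 rewrite +-identityʳ (y 2 + 1) | +-identityʳ (y 2) = m+n∸n≡m (y 2) 1
short-round-≗ y 3 = cong (_+ 1) (+-identityʳ (y 3))
short-round-≗ y (suc (suc (suc (suc k)))) = +-identityʳ (y (4 + k) + 0)

long-round-≗ : ∀ y → 4 ≤ y 1 → play (play (play y sp1) sp1) sp2 ≗ ones-to-three y
long-round-≗ y _ 0 rewrite +-identityʳ (y 0 + 0) = +-identityʳ (y 0 + 0)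
long-round-≗ y 4≤y₁ 1 rewrite +-identityʳ (y 1) | +-identityʳ (y 1 ∸ 2) | ∸-+-assoc (y 1) 2 2 =
  trans (sym (+-∸-comm 1 4≤y₁)) (cong (_∸ 4) (+-comm (y 1) 1))
long-round-≗ y _ 2 rewrite +-identityʳ (y 2 + 1 + 1) | +-identityʳ (y 2) | +-assoc (y 2) 1 1 = m+n∸n≡m (y 2) 2
long-round-≗ y _ 3 rewrite +-identityʳ (y 3 + 0) | +-identityʳ (y 3) = refl
long-round-≗ y _ (suc (suc (suc (suc k)))) rewrite +-identityʳ (y (4 + k) + 0) = +-identityʳ (y (4 + k) + 0)

ones-to-three-supported : ∀ {y N} → 4 ≤ N → Supported y N → Supported (ones-to-three y) N
ones-to-three-supported {y} 4≤N (y0 , beyond) = trans (+-identityʳ (y 0)) y0 , vanish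
  where
  vanish : ∀ k → _ ≤ k → ones-to-three y k ≡ 0
  vanish k N≤k rewrite δ-< (<-≤-trans (n<1+n 3) (≤-trans 4≤N N≤k))
                     | δ-< (<-≤-trans (s≤s (s≤s z≤n)) (≤-trans 4≤N N≤k))
                     | +-identityʳ (y k) = beyond k N≤k

iterate-supported : ∀ m {y N} → 4 ≤ N → Supported y N → Supported (iterate ones-to-three y m) N
iterate-supported zero _ sup = sup
iterate-supported (suc m) 4≤N sup = iterate-supported m 4≤N (ones-to-three-supported 4≤N sup)

iterate-ones : ∀ m {y c} → m * 3 + c ≤ y 1 → c ≤ iterate ones-to-three y m 1
iterate-ones zero h = h
iterate-ones (suc m) h = iterate-ones m (c+m≤n⇒m≤n+0∸c 3 h)

Streak : (ℕ → Set) → ℕ → ℕ → Set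
Streak P t L = ∀ k → k < L → P (k + t)

Streak-prefix : ∀ {P t L L'} → L' ≤ L → Streak P t L → Streak P t L'
Streak-prefix L'≤L streak k k<L' = streak k (<-≤-trans k<L' L'≤L)

Streak-drop : ∀ {P t} a {b} → Streak P t (a + b) → Streak P (a + t) b
Streak-drop {P} {t} a {b} streak k k<b =
  subst P (+-assoc k a t) (streak (k + a) (subst (_< a + b) (+-comm a k) (+-monoʳ-< a k<b)))

module _ {P : ℕ → Set} where

  Trade : ℕ → Set
  Trade k = ∀ {y t} → Streak P t k → 4 ≤ y 1 → Wins P (ones-to-three y) (k + t) → Wins P y t

  short-round : Trade 2
  short-round {y} streak 4≤y₁ w =
    ally (streak 0 (s≤s z≤n)) _ (rule-move sp1 2≤y₁) (inj₂
    (ally (streak 1 ≤-refl) _ (rule-move (comb 1) (≤-refl , c+m≤n⇒m≤n+0∸c 2 3≤y₁ , m≤n+m 1 (y 2))) (inj₂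
    (Wins-resp (sym ∘ short-round-≗ y) w))))
    where 3≤y₁ = ≤-trans (n≤1+n 3) 4≤y₁
          2≤y₁ = ≤-trans (n≤1+n 2) 3≤y₁

  long-round : Trade 3
  long-round {y} streak 4≤y₁ w =
    ally (streak 0 (s≤s z≤n)) _ (rule-move sp1 2≤y₁) (inj₂
    (ally (streak 1 (s≤s (s≤s z≤n))) _ (rule-move sp1 (c+m≤n⇒m≤n+0∸c 2 4≤y₁)) (inj₂
    (ally (streak 2 ≤-refl) _ (rule-move sp2 2≤y₂+1+1) (inj₂
    (Wins-resp (sym ∘ long-round-≗ y 4≤y₁) w))))))
    where 2≤y₁ = ≤-trans (n≤1+n 2) (≤-trans (n≤1+n 3) 4≤y₁)
          2≤y₂+1+1 = subst (2 ≤_) (sym (+-assoc (y 2) 1 1)) (m≤n+m 2 (y 2))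

  rounds : ∀ k → Trade k → ∀ m {y t} → Streak P t (m * k) → m * 3 + 1 ≤ y 1 →
           Wins P (iterate ones-to-three y m) (m * k + t) → Wins P y t
  rounds k round zero _ _ w = w
  rounds k round (suc m) {y} {t} streak h w =
    round (Streak-prefix {P} (m≤m+n k (m * k)) streak) (≤-trans (s≤s (s≤s (s≤s (m≤n+m 1 (m * 3))))) h)
      (rounds k round m (Streak-drop {P} k streak) (c+m≤n⇒m≤n+0∸c 3 h)
        (subst (Wins P _) (+-reassoc k (m * k) t) w))
    where +-reassoc : ∀ a b c → a + b + c ≡ b + (a + c)
          +-reassoc = solve-∀

play-removes-at-most-2 : ∀ {s} r → Applicable s r → ∀ {k x} → 2 + x ≤ s k → x ≤ play s r k
play-removes-at-most-2 {s} r a {k} {x} h = +-cancelʳ-≤ 2 x (play s r k) (begin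
  x + 2                        ≡⟨ +-comm x 2 ⟩
  2 + x                        ≤⟨ h ⟩
  s k                          ≤⟨ m≤m+n (s k) (added r k) ⟩
  s k + added r k              ≡⟨ play-balance {s} r a k ⟨
  play s r k + removed r k     ≤⟨ +-monoʳ-≤ (play s r k) (removed≤2 r k) ⟩
  play s r k + 2               ∎)
  where open ≤-Reasoning

module Strategy {P : ℕ → Set} (P? : ∀ t → Dec (P t)) where

  wait : ∀ K d {s N t} → Supported s N → d * 2 + K ≤ s 1 →
         (∀ {s' N'} → Supported s' N' → K ≤ s' 1 → Wins P s' (t + d)) → Wins P s t
  wait K zero {t = t} sup h cont = subst (Wins P _) (+-identityʳ t) (cont sup h)
  wait K (suc d) {s} {N} {t} sup h cont = [ allied , opposed ]′ (toSum (P? t))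
    where
    2≤s₁ : 2 ≤ s 1
    2≤s₁ = ≤-trans (m≤m+n 2 (d * 2 + K)) h
    cont' : ∀ {s' N'} → Supported s' N' → K ≤ s' 1 → Wins P s' (suc t + d)
    cont' sup' h' = subst (Wins P _) (+-suc t d) (cont sup' h')
    allied : P t → Wins P s t
    allied pt = ally pt _ (rule-move sp1 2≤s₁)
      (inj₂ (wait K d (play-supported sp1 sup 2≤s₁) (c+m≤n⇒m≤n+0∸c 2 h) cont'))
    opposed : ¬ P t → Wins P s t
    opposed ¬pt = enemy ¬pt (λ (≤1 , _) → 1+n≰n (≤-trans 2≤s₁ (≤1 1))) λ s' m →
      let (r , a , s'≗) = move-rule m in
      Wins-resp (sym ∘ s'≗) (wait K d (play-supported r sup a) (play-removes-at-most-2 r a h) cont')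

  module _ (b : ℕ) (catch-up : ∀ u → ¬ P (u + b) → P u) where

    tempo : ∀ {y N t} → Streak P t (b * 3) → Supported y N → b * 3 + 2 ≤ y 1 → Wins P y t
    tempo {y} {N} {t} streak sup h =
      [ rounds 3 long-round b streak h₁
      , (λ w → rounds 2 short-round b (Streak-prefix {P} (*-monoʳ-≤ b (n≤1+n 2)) streak) h₁
                 (Wins-mono P? catch-up sup' (Wins-shift b (b * 2 + t) (subst (Wins _ _) (regroup b t) w))))
      ]′ (determined P? sup' ¬z (b * 3 + t))
      where
      z = iterate ones-to-three y b
      sup' : Supported z (N + 4)
      sup' = iterate-supported b (m≤n+m 4 N) (Supported-weaken (m≤m+n N 4) sup)
      ¬z : ¬ Zeckendorf z
      ¬z (≤1 , _) = 1+n≰n (≤-trans (iterate-ones b h) (≤1 1))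
      h₁ : b * 3 + 1 ≤ y 1
      h₁ = ≤-trans (+-monoʳ-≤ (b * 3) (n≤1+n 1)) h
      regroup : ∀ b t → b * 3 + t ≡ b * 2 + t + b
      regroup = solve-∀

start-supported : ∀ n → Supported (start n) 2
start-supported n = *-zeroʳ n , λ { (suc (suc k)) _ → *-zeroʳ n ; 1 (s≤s ()) }

mod-≡ : ∀ {m n p} .{{_ : NonZero p}} → m % p ≡ n % p → m mod p ≡ n mod p
mod-≡ {m} {n} {p} eq = fromℕ<-cong _ _ eq (m%n<n m p) (m%n<n n p)

module _ (p : ℕ) .{{_ : NonZero p}} (A : Subset p) where

  Allied : ℕ → Set
  Allied t = t mod p ∈ A

  Wins⇒Win : ∀ {s t} → Wins Allied s t → Game.Win p A s t
  Wins⇒Win (ally pt s' m (inj₁ z)) = Game.ally pt s' m (inj₁ z)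
  Wins⇒Win (ally pt s' m (inj₂ w)) = Game.ally pt s' m (inj₂ (Wins⇒Win w))
  Wins⇒Win (enemy ¬pt ¬z next) = Game.enemy ¬pt ¬z λ s' m → Wins⇒Win (next s' m)

  Allied-block : ∀ s₀ {L} → (∀ k → k < L → (s₀ + k) mod p ∈ A) → Streak Allied (s₀ % p) L
  Allied-block s₀ block k k<L = subst (_∈ A) (mod-≡ (begin
    (s₀ + k) % p                 ≡⟨ %-distribˡ-+ s₀ k p ⟩
    (s₀ % p + k % p) % p         ≡⟨ cong (λ x → (x + k % p) % p) (m%n%n≡m%n s₀ p) ⟨
    (s₀ % p % p + k % p) % p     ≡⟨ %-distribˡ-+ (s₀ % p) k p ⟨
    (s₀ % p + k) % p             ≡⟨ cong (_% p) (+-comm (s₀ % p) k) ⟩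
    (k + s₀ % p) % p             ∎)) (block k k<L)
    where open ≡-Reasoning

theorem1p3p6 : (n p b : ℕ) .{{_ : NonZero p}} (A : Subset p) →
               (∀ i → (i + b) mod p ∉ A → i mod p ∈ A) →
               (∃ λ s → ∀ k → k < 3 * b → (s + k) mod p ∈ A) →
               2 * p + 4 * b ≤ n →
               Game.HasWinningStrategy p A n
theorem1p3p6 n p b A catch-up (s₀ , block) n≥ =
  Wins⇒Win p A (wait (b * 3 + 2) (s₀ % p) (start-supported n) budget λ sup h → tempo b catch-up streak sup h)
  where
  open Strategy (λ t → t mod p ∈? A)
  streak : Streak (Allied p A) (s₀ % p) (b * 3)
  streak = Allied-block p A s₀ λ k k<3b → block k (subst (k <_) (*-comm b 3) k<3b)
  budget : s₀ % p * 2 + (b * 3 + 2) ≤ n * 1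
  budget = begin
    s₀ % p * 2 + (b * 3 + 2)     ≡⟨ regroup (s₀ % p) b ⟩
    2 * suc (s₀ % p) + 3 * b     ≤⟨ +-mono-≤ (*-monoʳ-≤ 2 (m%n<n s₀ p)) (*-monoˡ-≤ b (n≤1+n 3)) ⟩
    2 * p + 4 * b                ≤⟨ n≥ ⟩
    n                            ≡⟨ *-identityʳ n ⟨
    n * 1                        ∎
    where open ≤-Reasoning
          regroup : ∀ t b → t * 2 + (b * 3 + 2) ≡ 2 * suc t + 3 * b
          regroup = solve-∀
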